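{- Let $m$ and $q$ be positive integers. For $1 \leq i \leq m$ let $\mathcal{H}_i = (V_i, E_i)$ be a hypergraph, where the vertex sets $V_1, \ldots, V_m$ are pairwise disjoint. Let $\mathcal{H} = (V, E)$ be the hypergraph with $V = \bigcup_{i=1}^m V_i$ and $E = \{\bigcup_{i=1}^m e_i : e_i \in E_i \text{ for all } i\}$. Let $Q = q\left(1 + \log\left(m + \left\lceil \frac{\sum_{i=1}^m |V_i|}{q+1} \right\rceil\right)\right)$. If, for every $1 \leq i \leq m$, Maker has a strategy to win the $(1 : Q)$ Maker-Breaker game on $\mathcal{H}_i$ within $t_i$ moves, then Maker has a strategy to win the $(1 : q)$ Maker-Breaker game on $\mathcal{H}$ within $\sum_{i=1}^m t_i$ moves.
   Context: A Maker-Breaker game on a hypergraph $\mathcal{H}=(V,E)$ with bias $(1:q)$: the board is the vertex set $V$ and the winning sets are the hyperedges in $E$. Maker and Breaker alternately claim previously unclaimed vertices of the board, Breaker going first; Maker claims $1$ vertex per turn and Breaker claims $q$ (or all remaining ones if fewer remain). Maker wins as soon as he has claimed all vertices of some hyperedge; otherwise Breaker wins. $\log$ denotes the natural logarithm. -}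

module Defs where

open import Data.Nat using (ℕ; zero; suc; _+_; _*_; _^_; _≤_; _<_; _⊓_)
open import Data.Nat.DivMod using (_/_)
open import Data.Fin using (Fin)
open import Data.List using (List; []; _∷_; _++_; length; filter; map; concatMap; allFin)
open import Data.Nat.ListAction using (sum)
open import Data.List.Membership.Propositional using (_∈_; _∉_)
open import Data.List.Relation.Unary.Any using (Any)
open import Data.List.Relation.Unary.All using (All)
open import Data.List.Relation.Unary.Unique.Propositional using (Unique)
open import Data.List.Relation.Binary.Subset.Propositional using (_⊆_)
open import Data.Product using (Σ; _×_; ∃-syntax)
open import Data.Sum using (_⊎_)
open import Relation.Nullary using (¬_; ¬?)
open import Relation.Nullary.Decidable using (_×-dec_)
open import Relation.Binary.Definitions using (DecidableEquality)
open import Relation.Binary.PropositionalEquality using (_≡_)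
open import Function using (_∘_)
import Data.List.Membership.DecPropositional as DecMem

record Hypergraph (V : Set) : Set where
  constructor hyp
  field
    vertices : List V
    edges    : List (List V)

open Hypergraph public

WellFormed : {V : Set} → Hypergraph V → Set
WellFormed H = Unique (vertices H) × All (_⊆ vertices H) (edges H)

-- The Maker-Breaker game with bias (1:q), Breaker first.
-- A position is (M, B): vertices claimed by Maker and by Breaker.
module Game {V : Set} (_≟_ : DecidableEquality V) (H : Hypergraph V) (q : ℕ) where
  open DecMem _≟_ using (_∈?_)

  Free : List V → List V → V → Set
  Free M B v = v ∈ vertices H × v ∉ M × v ∉ B

  freeList : List V → List V → List V
  freeList M B = filter (λ v → ¬? (v ∈? M) ×-dec ¬? (v ∈? B)) (vertices H)

  Won : List V → Set
  Won M = Any (_⊆ M) (edges H)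

  BreakerMove : List V → List V → List V → Set
  BreakerMove M B S =
    Unique S × All (Free M B) S × length S ≡ q ⊓ length (freeList M B)

  MakerWinsWithin : ℕ → List V → List V → Set
  MakerWinsWithin zero    M B = Won M
  MakerWinsWithin (suc t) M B =
    Won M ⊎
    ((S : List V) → BreakerMove M B S →
       ∃[ v ] (Free M (S ++ B) v × MakerWinsWithin t (v ∷ M) (S ++ B)))

MakerWins : {V : Set} → DecidableEquality V → Hypergraph V → ℕ → ℕ → Set
MakerWins _≟_ H q t = Game.MakerWinsWithin _≟_ H q t [] []

choices : {V : Set} → List (List (List V)) → List (List V)
choices []          = [] ∷ []
choices (Es ∷ rest) = concatMap (λ e → map (e ++_) (choices rest)) Es

unionHyp : {V : Set} (m : ℕ) → (Fin m → Hypergraph V) → Hypergraph V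
unionHyp m H =
  hyp (concatMap (vertices ∘ H) (allFin m))
      (choices (map (edges ∘ H) (allFin m)))

ceilDivSuc : ℕ → ℕ → ℕ
ceilDivSuc a q = (a + q) / suc q

-- LeQ q N b  expresses the real inequality  b ≤ q (1 + log N)  (N ≥ 1):
-- either b ≤ q (then it holds since log N ≥ 0), or b = q + a with a ≥ 1 and
-- e^a ≤ N^q; as e^a is irrational this is e^a < N^q, which holds iff some
-- upper bound (1 + 1/n)^(n+1) of e (these decrease to e) satisfies
-- ((n+1)/n)^((n+1)a) < N^q, i.e. (n+1)^((n+1)a) < N^q · n^((n+1)a).
LeQ : ℕ → ℕ → ℕ → Set
LeQ q N b =
  b ≤ q ⊎
  Σ ℕ (λ a → b ≡ q + suc a ×
    Σ ℕ (λ n → suc n ^ (suc n * suc a) < N ^ q * n ^ (suc n * suc a)))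

IsFloorQ : ℕ → ℕ → ℕ → Set
IsFloorQ q N Qf = LeQ q N Qf × ¬ LeQ q N (suc Qf)

sumFin : (m : ℕ) → (Fin m → ℕ) → ℕ
sumFin m f = sum (map f (allFin m))

{-# OPTIONS --safe #-}
-- Maker plays the m component games side by side and holds Breaker's vertices in V_i back as
-- pending for the game on H_i.  In each round he picks, among the components not yet won, one with
-- the most pending vertices, hands them (padded to Q free vertices) to the simulated game on H_i as a
-- single Breaker move and answers there.  Every round spends one move of one component strategy, so
-- Maker wins within t_1 + … + t_m rounds, provided no component ever has more than Q pending vertices.
-- That is a Box game in which Breaker adds q per round and Maker empties the fullest box: after r
-- rounds any j unfinished boxes hold at most q j (1/(j+1) + … + 1/(j+r)), so the emptied box holds at
-- most q (1 + 1/2 + … + 1/(r+1)) ≤ q (1 + log N), because counting claimed vertices gives r + 1 ≤ N.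
-- Harmonic sums are compared with log N through (1 + 1/n)^((n+1)/j) ≤ j/(j-1) and (1 + 1/n)^(n+1) > e,
-- with n + 1 a common multiple of 1, …, N.
module Submission where

open import Defs
open import Data.Nat
open import Data.Nat.Properties
open import Data.Nat.Tactic.RingSolver using (solve-∀)
open import Data.Nat.DivMod using (m*n/n≡m; /-monoˡ-≤)
open import Data.Nat.ListAction using (sum)
open import Data.Product using (Σ; _,_; _×_; proj₁; proj₂; ∃; ∃-syntax)
open import Data.Sum using (_⊎_; inj₁; inj₂; [_,_]′)
open import Data.Fin using (Fin) renaming (_≟_ to _≟ᶠ_)
open import Data.Fin.Properties using (any?)
open import Data.List using (List; []; _∷_; _++_; length; map; filter; take; concatMap; allFin)
open import Data.List.Properties using (length-filter; filter-notAll; length-take; length-++; filter-++; filter-none; map-cong)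
open import Data.List.Relation.Unary.All as All using (All; []; _∷_)
import Data.List.Relation.Unary.All.Properties as All
open import Data.List.Relation.Unary.Any as Any using (Any; here; there)
import Data.List.Relation.Unary.Any.Properties as Any
import Data.List.Relation.Unary.AllPairs as AllPairs
import Data.List.Relation.Unary.AllPairs.Properties as AllPairs
open import Data.List.Relation.Unary.Unique.Propositional using (Unique; []; _∷_)
import Data.List.Relation.Unary.Unique.Propositional.Properties as Unique
open import Data.List.Membership.Propositional using (_∈_; _∉_)
open import Data.List.Membership.Propositional.Properties
import Data.List.Membership.DecPropositional as DecMembership
open import Data.List.Relation.Binary.Subset.Propositional using (_⊆_)
open import Data.List.Relation.Binary.Subset.Propositional.Properties using (⊆-trans; xs⊆x∷xs; ∷⁺ʳ)
import Data.List.Relation.Binary.Subset.DecPropositional as DecSubset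
open import Data.List.Relation.Binary.Disjoint.Propositional using (Disjoint)
open import Data.List.Extrema.Nat using (argmax; argmax-all; f[xs]≤f[argmax])
open import Function using (_∘_)
open import Relation.Binary.Definitions using (DecidableEquality)
open import Relation.Binary.PropositionalEquality
open import Relation.Nullary using (¬_; ¬?; Dec; yes; no; contradiction)
open import Relation.Nullary.Decidable using (_×-dec_; decidable-stable)
open import Relation.Unary using (Decidable)

-- Harmonic sums and logarithms

mutual
  bernoulli-≤ : ∀ c k → suc c ^ suc k ≤ c ^ suc k + suc k * suc c ^ k
  bernoulli-≤ c zero    = ≤-reflexive (base c)
    where base : ∀ c → suc c * 1 ≡ c * 1 + 1 * 1
          base = solve-∀
  bernoulli-≤ c (suc k) = <⇒≤ (bernoulli-< c k)

  bernoulli-< : ∀ c k → suc c ^ suc (suc k) < c ^ suc (suc k) + suc (suc k) * suc c ^ suc k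
  bernoulli-< c k = begin-strict
    suc c * suc c ^ suc k               ≤⟨ *-monoʳ-≤ (suc c) (bernoulli-≤ c k) ⟩
    suc c * (x + suc k * y)             ≡⟨ expand c x y k ⟩
    c * x + x + suc k * (suc c * y)     <⟨ +-monoˡ-< _ (+-monoʳ-< (c * x) (^-monoˡ-< (suc k) (n<1+n c))) ⟩
    c * x + suc c * y + suc k * (suc c * y) ≡⟨ collect (c * x) (suc c * y) k ⟩
    c * x + suc (suc k) * (suc c * y)   ∎
    where
      open ≤-Reasoning
      x = c ^ suc k
      y = suc c ^ k
      expand : ∀ c x y k → suc c * (x + suc k * y) ≡ c * x + x + suc k * (suc c * y)
      expand = solve-∀
      collect : ∀ a z k → a + z + suc k * z ≡ a + suc (suc k) * z
      collect = solve-∀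

private
  absorb : ∀ a k x y → suc a * (x + k * y) ≡ suc a * x + suc a * k * y
  absorb = solve-∀

-- With j = a + 1 and k = (n + 1) / j:  (1 + 1/n)^((n+1)/j) ≤ j / (j - 1),  a discrete form of  1/j ≤ log (j / (j - 1)).
weightStep-≤ : ∀ a k n → suc a * k ≡ suc n → a * suc n ^ k ≤ suc a * n ^ k
weightStep-≤ a zero    n eq = contradiction (trans (sym (*-zeroʳ (suc a))) eq) 0≢1+n
weightStep-≤ a (suc k) n eq = +-cancelʳ-≤ (suc n ^ suc k) _ _ (begin
  a * suc n ^ suc k + suc n ^ suc k   ≡⟨ +-comm (a * suc n ^ suc k) _ ⟩
  suc a * suc n ^ suc k               ≤⟨ *-monoʳ-≤ (suc a) (bernoulli-≤ n k) ⟩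
  suc a * (n ^ suc k + suc k * suc n ^ k)   ≡⟨ absorb a (suc k) (n ^ suc k) (suc n ^ k) ⟩
  suc a * n ^ suc k + suc a * suc k * suc n ^ k ≡⟨ cong (λ d → suc a * n ^ suc k + d * suc n ^ k) eq ⟩
  suc a * n ^ suc k + suc n ^ suc k   ∎)
  where open ≤-Reasoning

weightStep-< : ∀ a k n → 2 ≤ k → suc a * k ≡ suc n → a * suc n ^ k < suc a * n ^ k
weightStep-< a (suc zero)    n (s≤s ()) _
weightStep-< a (suc (suc k)) n _ eq = +-cancelʳ-< (suc n ^ K) _ _ (begin-strict
  a * suc n ^ K + suc n ^ K           ≡⟨ +-comm (a * suc n ^ K) _ ⟩
  suc a * suc n ^ K                   <⟨ *-monoʳ-< (suc a) (bernoulli-< n k) ⟩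
  suc a * (n ^ K + K * suc n ^ suc k) ≡⟨ absorb a K (n ^ K) (suc n ^ suc k) ⟩
  suc a * n ^ K + suc a * K * suc n ^ suc k ≡⟨ cong (λ d → suc a * n ^ K + d * suc n ^ suc k) eq ⟩
  suc a * n ^ K + suc n ^ K           ∎)
  where
    open ≤-Reasoning
    K = suc (suc k)

private
  split-^ : ∀ x P k l → x * P ^ (k + l) ≡ x * P ^ k * P ^ l
  split-^ x P k l = trans (cong (x *_) (^-distribˡ-+-* P k l)) (sym (*-assoc x _ _))

  swap : ∀ a b c → a * b * c ≡ b * (a * c)
  swap = solve-∀

  join-^ : ∀ z n k l → n ^ k * (z * n ^ l) ≡ z * n ^ (k + l)
  join-^ z n k l = trans (sym (swap z (n ^ k) (n ^ l))) (sym (split-^ z n k l))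

-- x * P ^ k ≤ y * n ^ k  reads  (P / n)^k ≤ y / x; these ratios multiply.
telescope-≤ : ∀ {x y z P n k l} → x * P ^ k ≤ y * n ^ k → y * P ^ l ≤ z * n ^ l →
              x * P ^ (k + l) ≤ z * n ^ (k + l)
telescope-≤ {x} {y} {z} {P} {n} {k} {l} first rest = begin
  x * P ^ (k + l)       ≡⟨ split-^ x P k l ⟩
  x * P ^ k * P ^ l     ≤⟨ *-monoˡ-≤ (P ^ l) first ⟩
  y * n ^ k * P ^ l     ≡⟨ swap y (n ^ k) (P ^ l) ⟩
  n ^ k * (y * P ^ l)   ≤⟨ *-monoʳ-≤ (n ^ k) rest ⟩
  n ^ k * (z * n ^ l)   ≡⟨ join-^ z n k l ⟩
  z * n ^ (k + l)       ∎
  where open ≤-Reasoning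

telescope-< : ∀ {x y z P n k l} .{{_ : NonZero P}} → x * P ^ k < y * n ^ k → y * P ^ l ≤ z * n ^ l →
              x * P ^ (k + l) < z * n ^ (k + l)
telescope-< {x} {y} {z} {P} {n} {k} {l} first rest = begin-strict
  x * P ^ (k + l)       ≡⟨ split-^ x P k l ⟩
  x * P ^ k * P ^ l     <⟨ *-monoˡ-< (P ^ l) {{m^n≢0 P l}} first ⟩
  y * n ^ k * P ^ l     ≡⟨ swap y (n ^ k) (P ^ l) ⟩
  n ^ k * (y * P ^ l)   ≤⟨ *-monoʳ-≤ (n ^ k) rest ⟩
  n ^ k * (z * n ^ l)   ≡⟨ join-^ z n k l ⟩
  z * n ^ (k + l)       ∎
  where open ≤-Reasoning

^-ratio-mono : ∀ {n P a b} → n ≤ P → a ≤ b → P ^ a * n ^ b ≤ P ^ b * n ^ a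
^-ratio-mono {n} {P} {a} n≤P a≤b with d , refl ← m≤n⇒∃[o]m+o≡n a≤b = begin
  P ^ a * n ^ (a + d)         ≡⟨ cong (P ^ a *_) (^-distribˡ-+-* n a d) ⟩
  P ^ a * (n ^ a * n ^ d)     ≤⟨ *-monoʳ-≤ (P ^ a) (*-monoʳ-≤ (n ^ a) (^-monoˡ-≤ d n≤P)) ⟩
  P ^ a * (n ^ a * P ^ d)     ≡⟨ rearrange (P ^ a) (n ^ a) (P ^ d) ⟩
  P ^ a * P ^ d * n ^ a       ≡⟨ cong (_* n ^ a) (^-distribˡ-+-* P a d) ⟨
  P ^ (a + d) * n ^ a         ∎
  where
    open ≤-Reasoning
    rearrange : ∀ x y z → x * (y * z) ≡ x * z * y
    rearrange = solve-∀

^-distribʳ-* : ∀ a b k → (a * b) ^ k ≡ a ^ k * b ^ k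
^-distribʳ-* a b zero    = refl
^-distribʳ-* a b (suc k) = trans (cong (a * b *_) (^-distribʳ-* a b k)) (interchange a b (a ^ k) (b ^ k))
  where interchange : ∀ a b x y → a * b * (x * y) ≡ a * x * (b * y)
        interchange = solve-∀

partialSum : (ℕ → ℕ) → ℕ → ℕ → ℕ
partialSum w a zero    = 0
partialSum w a (suc r) = w (suc a) + partialSum w (suc a) r

-- With  j * w j = n + 1  for  1 ≤ j ≤ N,  w j plays the role of (n+1)/j, and
-- partialSum w a r = (n+1) (1/(a+1) + … + 1/(a+r)).
module Harmonic {N n : ℕ} {w : ℕ → ℕ} .{{_ : NonZero n}} (w-harmonic : ∀ j → 1 ≤ j → j ≤ N → j * w j ≡ suc n)
                (w-≥2 : ∀ j → 1 ≤ j → j ≤ N → 2 ≤ w j) where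

  private
    suc-a≤N : ∀ {a r} → a + suc r ≤ N → suc a ≤ N
    suc-a≤N {a} {r} a+r<N = ≤-trans (s≤s (m≤m+n a r)) (≤-trans (≤-reflexive (sym (+-suc a r))) a+r<N)

    harmonic-suc : ∀ {a r} → a + suc r ≤ N → suc a * w (suc a) ≡ suc n
    harmonic-suc a+r<N = w-harmonic _ (s≤s z≤n) (suc-a≤N a+r<N)

    shift : ∀ {a r} → a + suc r ≤ N → suc a + r ≤ N
    shift {a} {r} = ≤-trans (≤-reflexive (sym (+-suc a r)))

    shifted : ∀ {x y} a r → x ≤ (suc a + r) * y → x ≤ (a + suc r) * y
    shifted {x} {y} a r = subst (λ c → x ≤ c * y) (sym (+-suc a r))

  partialProduct-≤ : ∀ a r → a + r ≤ N → a * suc n ^ partialSum w a r ≤ (a + r) * n ^ partialSum w a r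
  partialProduct-≤ a zero    _     = ≤-reflexive (cong (_* 1) (sym (+-identityʳ a)))
  partialProduct-≤ a (suc r) a+r≤N =
    telescope-≤ {a} {suc a} {a + suc r} {suc n} {n} {w (suc a)} {partialSum w (suc a) r}
    (weightStep-≤ a _ n (harmonic-suc a+r≤N))
    (shifted a r (partialProduct-≤ (suc a) r (shift a+r≤N)))

  partialProduct-< : ∀ a r → a + suc r ≤ N →
                     a * suc n ^ partialSum w a (suc r) < (a + suc r) * n ^ partialSum w a (suc r)
  partialProduct-< a r a+r<N =
    telescope-< {a} {suc a} {a + suc r} {suc n} {n} {w (suc a)} {partialSum w (suc a) r}
    (weightStep-< a _ n (w-≥2 _ (s≤s z≤n) (suc-a≤N a+r<N)) (harmonic-suc a+r<N))
    (shifted a r (partialProduct-≤ (suc a) r (shift a+r<N)))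

  partialPower-< : ∀ r q .{{_ : NonZero q}} → 2 + r ≤ N →
                   suc n ^ (partialSum w 1 (suc r) * q) < (2 + r) ^ q * n ^ (partialSum w 1 (suc r) * q)
  partialPower-< r q 2+r≤N = begin-strict
    suc n ^ (S * q)             ≡⟨ ^-*-assoc (suc n) S q ⟨
    (suc n ^ S) ^ q             ≡⟨ cong (_^ q) (*-identityˡ (suc n ^ S)) ⟨
    (1 * suc n ^ S) ^ q         <⟨ ^-monoˡ-< q (partialProduct-< 1 r 2+r≤N) ⟩
    ((2 + r) * n ^ S) ^ q       ≡⟨ ^-distribʳ-* (2 + r) (n ^ S) q ⟩
    (2 + r) ^ q * (n ^ S) ^ q   ≡⟨ cong ((2 + r) ^ q *_) (^-*-assoc n S q) ⟩
    (2 + r) ^ q * n ^ (S * q)   ∎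
    where
      open ≤-Reasoning
      S = partialSum w 1 (suc r)

  -- As (1 + 1/n)^(n+1) > e, the conclusion gives e^(b+1) < N^q; it is the witness LeQ asks for.
  exp-excess-< : ∀ q r b .{{_ : NonZero q}} → suc r ≤ N →
             suc n * suc b ≤ q * partialSum w 1 r → suc n ^ (suc n * suc b) < N ^ q * n ^ (suc n * suc b)
  exp-excess-< q zero    b r<N b≤ = contradiction (≤-trans b≤ (≤-reflexive (*-zeroʳ q))) λ ()
  exp-excess-< q (suc r) b r<N b≤ = *-cancelʳ-< (n ^ E) _ _ (begin-strict
    suc n ^ B * n ^ E             ≤⟨ ^-ratio-mono (n≤1+n n) B≤E ⟩
    suc n ^ E * n ^ B             <⟨ *-monoˡ-< (n ^ B) {{m^n≢0 n B}} (partialPower-< r q r<N) ⟩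
    (2 + r) ^ q * n ^ E * n ^ B   ≤⟨ *-monoˡ-≤ (n ^ B) (*-monoˡ-≤ (n ^ E) (^-monoˡ-≤ q r<N)) ⟩
    N ^ q * n ^ E * n ^ B         ≡⟨ *-assoc (N ^ q) _ _ ⟩
    N ^ q * (n ^ E * n ^ B)       ≡⟨ cong (N ^ q *_) (*-comm (n ^ E) _) ⟩
    N ^ q * (n ^ B * n ^ E)       ≡⟨ *-assoc (N ^ q) _ _ ⟨
    N ^ q * n ^ B * n ^ E         ∎)
    where
      open ≤-Reasoning
      B = suc n * suc b
      E = partialSum w 1 (suc r) * q
      B≤E : B ≤ E
      B≤E = ≤-trans b≤ (≤-reflexive (*-comm q _))

  harmonic⇒LeQ : ∀ q r L .{{_ : NonZero q}} → suc r ≤ N →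
                 suc n * L ≤ q * (suc n + partialSum w 1 r) → LeQ q N L
  harmonic⇒LeQ q r L r<N bound with L ≤? q
  ... | yes L≤q = inj₁ L≤q
  ... | no L≰q with b , refl ← m≤n⇒∃[o]m+o≡n (≰⇒> L≰q) =
    inj₂ (b , sym (+-suc q b) , n , exp-excess-< q r b r<N (cancel (suc n) q b _ bound))
    where
      cancel : ∀ D q b S → D * (suc q + b) ≤ q * (D + S) → D * suc b ≤ q * S
      cancel D q b S le = +-cancelˡ-≤ (q * D) _ _ (begin
        q * D + D * suc b   ≡⟨ rearrange D q b ⟩
        D * (suc q + b)     ≤⟨ le ⟩
        q * (D + S)         ≡⟨ *-distribˡ-+ q D S ⟩
        q * D + q * S       ∎)
        where
          open ≤-Reasoning
          rearrange : ∀ D q b → q * D + D * suc b ≡ D * (suc q + b)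
          rearrange = solve-∀

  harmonic≤floor : ∀ q r L {Qf} .{{_ : NonZero q}} → IsFloorQ q N Qf → suc r ≤ N →
                   suc n * L ≤ q * (suc n + partialSum w 1 r) → L ≤ Qf
  harmonic≤floor q r L {Qf} (_ , ¬LeQ) r<N bound with L ≤? Qf
  ... | yes L≤Qf = L≤Qf
  ... | no L≰Qf  = contradiction
    (harmonic⇒LeQ q r (suc Qf) r<N (≤-trans (*-monoʳ-≤ (suc n) (≰⇒> L≰Qf)) bound)) ¬LeQ

module HarmonicWeights (N : ℕ) where
  open import Data.Nat.Divisibility using (_∣_; m≤n⇒m!∣n!; m∣m*n; ∣-trans; ∣n⇒∣m*n; ∣⇒≤)
  open import Data.Nat.DivMod using (m*[n/m]≡n)

  private
    instance
      N!≢0 : NonZero (N !)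
      N!≢0 = N !≢0

    scale : ℕ
    scale = 2 * N !

    ∣N! : ∀ j → suc j ≤ N → suc j ∣ N !
    ∣N! j j<N = ∣-trans (m∣m*n (j !)) (m≤n⇒m!∣n! j<N)

  n : ℕ
  n = pred scale

  instance
    n≢0 : NonZero n
    n≢0 = >-nonZero (pred-mono-≤ (*-monoʳ-≤ 2 (1≤n! N)))

  weight : ℕ → ℕ
  weight zero    = 0
  weight (suc j) = scale / suc j

  weight-harmonic : ∀ j → 1 ≤ j → j ≤ N → j * weight j ≡ suc n
  weight-harmonic (suc j) _ j<N = trans (m*[n/m]≡n (∣n⇒∣m*n 2 (∣N! j j<N))) (sym (suc-pred scale {{m*n≢0 2 (N !)}}))

  weight-≥2 : ∀ j → 1 ≤ j → j ≤ N → 2 ≤ weight j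
  weight-≥2 (suc j) _ j<N = *-cancelˡ-≤ (suc j) (begin
    suc j * 2            ≡⟨ *-comm (suc j) 2 ⟩
    2 * suc j            ≤⟨ *-monoʳ-≤ 2 (∣⇒≤ (∣N! j j<N)) ⟩
    scale                ≡⟨ m*[n/m]≡n (∣n⇒∣m*n 2 (∣N! j j<N)) ⟨
    suc j * weight (suc j) ∎)
    where open ≤-Reasoning

module _ {A : Set} where

  Unique-∷ : ∀ {x} {xs : List A} → x ∉ xs → Unique xs → Unique (x ∷ xs)
  Unique-∷ {xs = xs} x∉xs uxs = All.tabulate (λ y∈xs x≡y → x∉xs (subst (_∈ xs) (sym x≡y) y∈xs)) ∷ uxs

  ∈-filter-⊎ : ∀ {P : A → Set} (P? : Decidable P) {x xs} → x ∈ xs → x ∈ filter P? xs ⊎ ¬ P x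
  ∈-filter-⊎ P? {x} x∈xs with P? x
  ... | yes Px = inj₁ (∈-filter⁺ P? x∈xs Px)
  ... | no ¬Px = inj₂ ¬Px

  ++-⊆ : ∀ {xs ys zs : List A} → xs ⊆ zs → ys ⊆ zs → xs ++ ys ⊆ zs
  ++-⊆ {xs} xs⊆ ys⊆ x∈ = [ xs⊆ , ys⊆ ]′ (∈-++⁻ xs x∈)

  sum-map-≤ : ∀ (f : A → ℕ) c xs → All (λ x → f x ≤ c) xs → sum (map f xs) ≤ length xs * c
  sum-map-≤ f c []       []          = z≤n
  sum-map-≤ f c (x ∷ xs) (fx≤c ∷ ≤c) = +-mono-≤ fx≤c (sum-map-≤ f c xs ≤c)

  sum-map-cong : ∀ {f g : A → ℕ} {xs} → All (λ x → f x ≡ g x) xs → sum (map f xs) ≡ sum (map g xs)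
  sum-map-cong []            = refl
  sum-map-cong (fx≡gx ∷ eqs) = cong₂ _+_ fx≡gx (sum-map-cong eqs)

  sum-map-+ : ∀ (f g : A → ℕ) xs → sum (map (λ x → f x + g x) xs) ≡ sum (map f xs) + sum (map g xs)
  sum-map-+ f g []       = refl
  sum-map-+ f g (x ∷ xs) = trans (cong (f x + g x +_) (sum-map-+ f g xs)) (interchange (f x) (g x) _ _)
    where interchange : ∀ a b c d → a + b + (c + d) ≡ a + c + (b + d)
          interchange = solve-∀

  sum-map-≥ : ∀ (f : A → ℕ) {x xs} → x ∈ xs → f x ≤ sum (map f xs)
  sum-map-≥ f (here refl) = m≤m+n _ _
  sum-map-≥ f {xs = y ∷ _} (there x∈) = ≤-trans (sum-map-≥ f x∈) (m≤n+m _ (f y))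

  sum-map-decrement : ∀ (f g : A → ℕ) a → f a ≡ suc (g a) → (∀ x → x ≢ a → f x ≡ g x) →
                      ∀ {xs} → Unique xs → a ∈ xs → sum (map f xs) ≡ suc (sum (map g xs))
  sum-map-decrement f g a fa f≡g (a∉ ∷ _) (here refl) =
    cong₂ _+_ fa (sum-map-cong (All.map (λ a≢x → f≡g _ (a≢x ∘ sym)) a∉))
  sum-map-decrement f g a fa f≡g {x ∷ xs} (x∉ ∷ u) (there a∈) = begin
    f x + sum (map f xs)          ≡⟨ cong₂ _+_ (f≡g x (All.lookup x∉ a∈)) (sum-map-decrement f g a fa f≡g u a∈) ⟩
    g x + suc (sum (map g xs))    ≡⟨ +-suc (g x) _ ⟩
    suc (g x + sum (map g xs))    ∎
    where open ≡-Reasoning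

  sum-map-remove : (_≟_ : DecidableEquality A) (f g : A → ℕ) (a : A) → f a ≡ 0 → (∀ x → x ≢ a → f x ≡ g x) →
                   ∀ xs → sum (map f xs) ≡ sum (map g (filter (λ x → ¬? (x ≟ a)) xs))
  sum-map-remove _≟_ f g a fa≡0 f≡g [] = refl
  sum-map-remove _≟_ f g a fa≡0 f≡g (x ∷ xs) with x ≟ a
  ... | yes refl = trans (cong (_+ sum (map f xs)) fa≡0) (sum-map-remove _≟_ f g a fa≡0 f≡g xs)
  ... | no x≢a   = cong₂ _+_ (f≡g x x≢a) (sum-map-remove _≟_ f g a fa≡0 f≡g xs)

length-concatMap : ∀ {A B : Set} (f : A → List B) xs → length (concatMap f xs) ≡ sum (map (length ∘ f) xs)
length-concatMap f []       = refl
length-concatMap f (x ∷ xs) = trans (length-++ (f x)) (cong (length (f x) +_) (length-concatMap f xs))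

module _ {A : Set} (_≟_ : DecidableEquality A) where
  open DecMembership _≟_ using (_∈?_)

  Unique-⊆⇒length≤ : ∀ {xs ys : List A} → Unique xs → xs ⊆ ys → length xs ≤ length ys
  Unique-⊆⇒length≤ {[]}     _            _     = z≤n
  Unique-⊆⇒length≤ {x ∷ xs} {ys} (x∉xs ∷ uxs) xs⊆ys = ≤-trans (s≤s (Unique-⊆⇒length≤ uxs xs⊆ys′)) shorter
    where
      ≢x? = λ y → ¬? (y ≟ x)
      xs⊆ys′ : xs ⊆ filter ≢x? ys
      xs⊆ys′ y∈xs = ∈-filter⁺ ≢x? (xs⊆ys (there y∈xs)) (λ y≡x → All.lookup x∉xs y∈xs (sym y≡x))
      shorter : length (filter ≢x? ys) < length ys
      shorter = filter-notAll ≢x? ys (Any.map (λ x≡y x≢y → x≢y (sym x≡y)) (xs⊆ys (here refl)))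

  extend-⊆ : ∀ {xs ys} k → Unique xs → Unique ys → ys ⊆ xs → length ys + k ≤ length xs →
             Σ (List A) λ zs → length zs ≡ k × Unique (ys ++ zs) × ys ++ zs ⊆ xs
  extend-⊆ {xs} {ys} k uxs uys ys⊆xs room =
    take k fresh ,
    trans (length-take k fresh) (m≤n⇒m⊓n≡m k≤) ,
    Unique.++⁺ uys (Unique.take⁺ k (Unique.filter⁺ ∉ys? uxs)) (λ (x∈ys , x∈zs) → proj₂ (member (∈-take x∈zs)) x∈ys) ,
    ++-⊆ ys⊆xs (proj₁ ∘ member ∘ ∈-take)
    where
      ∉ys? = λ x → ¬? (x ∈? ys)
      fresh = filter ∉ys? xs
      member : ∀ {x} → x ∈ fresh → x ∈ xs × x ∉ ys
      member = ∈-filter⁻ ∉ys? {xs = xs}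
      covered : xs ⊆ ys ++ fresh
      covered {x} x∈xs with x ∈? ys
      ... | yes x∈ys = ∈-++⁺ˡ x∈ys
      ... | no  x∉ys = ∈-++⁺ʳ ys (∈-filter⁺ ∉ys? x∈xs x∉ys)
      k≤ : k ≤ length fresh
      k≤ = +-cancelˡ-≤ (length ys) _ _
        (≤-trans room (≤-trans (Unique-⊆⇒length≤ uxs covered) (≤-reflexive (length-++ ys))))
      ∈-take : ∀ {x n zs} → x ∈ take n zs → x ∈ zs
      ∈-take {n = suc n} {_ ∷ zs} (here x≡z) = here x≡z
      ∈-take {n = suc n} {_ ∷ zs} (there x∈) = there (∈-take x∈)

  full-move : ∀ {xs ys : List A} q {y} → length xs ≡ q ⊓ length ys → Unique xs → xs ⊆ ys → y ∈ ys → y ∉ xs →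
              length xs ≡ q
  full-move {xs} {ys} q {y} |xs| uxs xs⊆ys y∈ys y∉xs with ⊓-sel q (length ys)
  ... | inj₁ q⊓≡q = trans |xs| q⊓≡q
  ... | inj₂ q⊓≡ys = contradiction (trans |xs| q⊓≡ys) (<⇒≢ (Unique-⊆⇒length≤ {y ∷ xs} (Unique-∷ y∉xs uxs) yxs⊆ys))
    where
      yxs⊆ys : y ∷ xs ⊆ ys
      yxs⊆ys (here refl) = y∈ys
      yxs⊆ys (there x∈)  = xs⊆ys x∈

  sum-length-filter-exclusive : ∀ {B : Set} {Q : B → A → Set} (Q? : ∀ b → Decidable (Q b)) →
    (∀ {b c x} → Q b x → Q c x → b ≡ c) → ∀ {xs bs} → Unique xs → Unique bs →
    sum (map (λ b → length (filter (Q? b) xs)) bs) ≤ length xs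
  sum-length-filter-exclusive {Q = Q} Q? exclusive {xs} {bs} uxs ubs = begin
    sum (map (λ b → length (filter (Q? b) xs)) bs)   ≡⟨ length-concatMap parts bs ⟨
    length (concatMap parts bs)                      ≤⟨ Unique-⊆⇒length≤ unique inside ⟩
    length xs                                        ∎
    where
      open ≤-Reasoning
      parts = λ b → filter (Q? b) xs
      unique : Unique (concatMap parts bs)
      unique = Unique.concat⁺ (All.map⁺ (All.universal (λ b → Unique.filter⁺ (Q? b) uxs) bs))
        (AllPairs.map⁺ (AllPairs.map (λ b≢c {_} (x∈b , x∈c) →
          b≢c (exclusive (proj₂ (∈-filter⁻ (Q? _) {xs = xs} x∈b)) (proj₂ (∈-filter⁻ (Q? _) {xs = xs} x∈c)))) ubs))
      inside : concatMap parts bs ⊆ xs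
      inside x∈ = proj₁ (∈-filter⁻ (Q? _) (proj₂ (Any.satisfied (∈-concatMap⁻ parts {xs = bs} x∈))))

-- The Box game

-- If s is a sum of k ≤ j terms, each at most c, then dropping the largest term c from c + s
-- keeps at most a j/(j+1) fraction.
averaging : ∀ D {k j s c X} → k ≤ j → s ≤ k * c → D * (c + s) ≤ X → suc j * (D * s) ≤ j * X
averaging D {k} {j} {s} {c} {X} k≤j s≤kc DT≤X = *-cancelˡ-≤ (suc k) (begin
  suc k * (suc j * (D * s))   ≡⟨ e₁ k j D s ⟩
  suc j * D * (suc k * s)     ≤⟨ *-monoʳ-≤ (suc j * D) ks ⟩
  suc j * D * (k * (c + s))   ≡⟨ e₂ k j D (c + s) ⟩
  suc j * k * (D * (c + s))   ≤⟨ *-monoʳ-≤ (suc j * k) DT≤X ⟩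
  suc j * k * X               ≤⟨ *-monoˡ-≤ X jk ⟩
  suc k * j * X               ≡⟨ *-assoc (suc k) j X ⟩
  suc k * (j * X)             ∎)
  where
    open ≤-Reasoning
    e₁ : ∀ k j D s → suc k * (suc j * (D * s)) ≡ suc j * D * (suc k * s)
    e₁ = solve-∀
    e₂ : ∀ k j D T → suc j * D * (k * T) ≡ suc j * k * (D * T)
    e₂ = solve-∀
    ks : suc k * s ≤ k * (c + s)
    ks = begin
      s + k * s       ≡⟨ +-comm s (k * s) ⟩
      k * s + s       ≤⟨ +-monoʳ-≤ (k * s) s≤kc ⟩
      k * s + k * c   ≡⟨ *-distribˡ-+ k s c ⟨
      k * (s + c)     ≡⟨ cong (k *_) (+-comm s c) ⟩
      k * (c + s)     ∎
    jk : suc j * k ≤ suc k * j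
    jk = begin
      k + j * k       ≤⟨ +-monoˡ-≤ (j * k) k≤j ⟩
      j + j * k       ≡⟨ cong (j +_) (*-comm j k) ⟩
      suc k * j       ∎

module BoxGame {N n : ℕ} {w : ℕ → ℕ} (w-harmonic : ∀ j → 1 ≤ j → j ≤ N → j * w j ≡ suc n) (m q : ℕ) where

  -- Any j active boxes hold at most  q j (1/(j+1) + … + 1/(j+r))  after r rounds.
  BoxInvariant : ℕ → (Fin m → ℕ) → (Fin m → Set) → Set
  BoxInvariant r ℓ active = ∀ j → j + r ≤ N → ∀ J → Unique J → All active J → length J ≤ j →
                            suc n * sum (map ℓ J) ≤ q * (j * partialSum w j r)

  boxInvariant-start : ∀ active → BoxInvariant 0 (λ _ → 0) active
  boxInvariant-start _ j _ J _ _ _ = begin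
    suc n * sum (map (λ _ → 0) J)   ≤⟨ *-monoʳ-≤ (suc n) (sum-map-≤ (λ _ → 0) 0 J (All.tabulate (λ _ → z≤n))) ⟩
    suc n * (length J * 0)          ≡⟨ cong (suc n *_) (*-zeroʳ (length J)) ⟩
    suc n * 0                       ≡⟨ *-zeroʳ (suc n) ⟩
    0                               ≤⟨ z≤n ⟩
    q * (j * 0)                     ∎
    where open ≤-Reasoning

  boxInvariant-step : ∀ {r ℓ active ℓ′ i ℓ″ active″} →
    BoxInvariant r ℓ active →
    (∀ J → Unique J → sum (map ℓ′ J) ≤ sum (map ℓ J) + q) →
    active i → (∀ j → active j → ℓ′ j ≤ ℓ′ i) →
    ℓ″ i ≡ 0 → (∀ j → j ≢ i → ℓ″ j ≡ ℓ′ j) →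
    (∀ j → active″ j → active j) →
    BoxInvariant (suc r) ℓ″ active″
  boxInvariant-step {r} {ℓ} {active} {ℓ′} {i} {ℓ″} inv breaker active-i maximal emptied kept shrinks
                    j j+r<N J uJ activeJ |J|≤j = *-cancelˡ-≤ (suc j) (begin
    suc j * (suc n * sum (map ℓ″ J))   ≡⟨ cong (λ t → suc j * (suc n * t)) (sum-map-remove _≟ᶠ_ ℓ″ ℓ′ i emptied kept J) ⟩
    suc j * (suc n * s)                ≤⟨ averaging (suc n) |J′|≤j s≤kc DK≤X ⟩
    j * (q * (suc j * S) + q * suc n)  ≡⟨ cong (λ t → j * (q * (suc j * S) + q * t)) (w-harmonic (suc j) (s≤s z≤n) j<N) ⟨
    j * (q * (suc j * S) + q * (suc j * w (suc j))) ≡⟨ regroup j q (w (suc j)) S ⟩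
    suc j * (q * (j * partialSum w j (suc r))) ∎)
    where
      open ≤-Reasoning
      ≢i? = λ x → ¬? (x ≟ᶠ i)
      J′ = filter ≢i? J
      K = i ∷ J′
      S = partialSum w (suc j) r
      s = sum (map ℓ′ J′)
      j+1+r≤N : suc j + r ≤ N
      j+1+r≤N = ≤-trans (≤-reflexive (sym (+-suc j r))) j+r<N
      j<N : suc j ≤ N
      j<N = ≤-trans (m≤m+n (suc j) r) j+1+r≤N
      member : ∀ {x} → x ∈ J′ → x ∈ J × x ≢ i
      member = ∈-filter⁻ ≢i? {xs = J}
      |J′|≤j : length J′ ≤ j
      |J′|≤j = ≤-trans (length-filter ≢i? J) |J|≤j
      activeJ′ : All active J′
      activeJ′ = All.tabulate λ x∈J′ → shrinks _ (All.lookup activeJ (proj₁ (member x∈J′)))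
      uK : Unique K
      uK = Unique-∷ (λ i∈J′ → proj₂ (member i∈J′) refl) (Unique.filter⁺ ≢i? uJ)
      s≤kc : s ≤ length J′ * ℓ′ i
      s≤kc = sum-map-≤ ℓ′ (ℓ′ i) J′ (All.map (maximal _) activeJ′)
      DK≤X : suc n * (ℓ′ i + s) ≤ q * (suc j * S) + q * suc n
      DK≤X = begin
        suc n * sum (map ℓ′ K)               ≤⟨ *-monoʳ-≤ (suc n) (breaker K uK) ⟩
        suc n * (sum (map ℓ K) + q)          ≡⟨ *-distribˡ-+ (suc n) _ q ⟩
        suc n * sum (map ℓ K) + suc n * q    ≤⟨ +-monoˡ-≤ _ (inv (suc j) j+1+r≤N K uK (active-i ∷ activeJ′) (s≤s |J′|≤j)) ⟩
        q * (suc j * S) + suc n * q          ≡⟨ cong (q * (suc j * S) +_) (*-comm (suc n) q) ⟩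
        q * (suc j * S) + q * suc n          ∎
      regroup : ∀ j q a b → j * (q * (suc j * b) + q * (suc j * a)) ≡ suc j * (q * (j * (a + b)))
      regroup = solve-∀

  boxInvariant-single : ∀ {r ℓ active ℓ′ i} → BoxInvariant r ℓ active → suc r ≤ N →
    (∀ J → Unique J → sum (map ℓ′ J) ≤ sum (map ℓ J) + q) → active i →
    suc n * ℓ′ i ≤ q * (suc n + partialSum w 1 r)
  boxInvariant-single {r} {ℓ} {_} {ℓ′} {i} inv r<N breaker active-i = begin
    suc n * ℓ′ i                    ≤⟨ *-monoʳ-≤ (suc n) ℓ′i≤ ⟩
    suc n * (ℓ i + q)               ≡⟨ *-distribˡ-+ (suc n) (ℓ i) q ⟩
    suc n * ℓ i + suc n * q         ≤⟨ +-monoˡ-≤ (suc n * q) Dℓi≤ ⟩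
    q * (1 * partialSum w 1 r) + suc n * q ≡⟨ regroup q (suc n) (partialSum w 1 r) ⟩
    q * (suc n + partialSum w 1 r)  ∎
    where
      open ≤-Reasoning
      single : Unique (i ∷ [])
      single = [] ∷ []
      ℓ′i≤ : ℓ′ i ≤ ℓ i + q
      ℓ′i≤ = subst₂ _≤_ (+-identityʳ (ℓ′ i)) (cong (_+ q) (+-identityʳ (ℓ i))) (breaker (i ∷ []) single)
      Dℓi≤ : suc n * ℓ i ≤ q * (1 * partialSum w 1 r)
      Dℓi≤ = subst (λ t → suc n * t ≤ _) (+-identityʳ (ℓ i)) (inv 1 r<N (i ∷ []) single (active-i ∷ []) ≤-refl)
      regroup : ∀ q D s → q * (1 * s) + D * q ≡ q * (D + s)
      regroup = solve-∀

-- Maker's strategy on the union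

module _ {m : ℕ} {C : Fin m → Set} where

  update : ((j : Fin m) → C j) → (i : Fin m) → C i → (j : Fin m) → C j
  update f i c j with j ≟ᶠ i
  ... | yes refl = c
  ... | no  _    = f j

  update-self : ∀ f i c → update f i c i ≡ c
  update-self f i c with i ≟ᶠ i
  ... | yes refl = refl
  ... | no  i≢i  = contradiction refl i≢i

  update-other : ∀ f {i} c {j} → j ≢ i → update f i c j ≡ f j
  update-other f {i} c {j} j≢i with j ≟ᶠ i
  ... | yes j≡i = contradiction j≡i j≢i
  ... | no  _   = refl

  update-elim : ∀ (P : (j : Fin m) → C j → Set) f i c → P i c → (∀ j → j ≢ i → P j (f j)) →
                ∀ j → P j (update f i c j)
  update-elim P f i c Pc Pf j with j ≟ᶠ i
  ... | yes refl = Pc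
  ... | no  j≢i  = Pf j j≢i

module _ {V : Set} (_≟_ : DecidableEquality V) (H : Hypergraph V) (q : ℕ) where
  open Game _≟_ H q
  open DecMembership _≟_ using (_∈?_)

  Free⇒∈freeList : ∀ {M B x} → Free M B x → x ∈ freeList M B
  Free⇒∈freeList {M} {B} (x∈V , x∉M , x∉B) = ∈-filter⁺ (λ v → ¬? (v ∈? M) ×-dec ¬? (v ∈? B)) x∈V (x∉M , x∉B)

  ∈freeList⇒Free : ∀ {M B x} → x ∈ freeList M B → Free M B x
  ∈freeList⇒Free {M} {B} = ∈-filter⁻ (λ v → ¬? (v ∈? M) ×-dec ¬? (v ∈? B)) {xs = vertices H}

choices⁺ : ∀ {V : Set} {M : List V} Ess → All (Any (_⊆ M)) Ess → Any (_⊆ M) (choices Ess)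
choices⁺ []         []          = here (λ ())
choices⁺ {M = M} (Es ∷ Ess) (e∈ ∷ rest) = Any.concatMap⁺ (λ e → map (e ++_) (choices Ess)) (Any.map extend e∈)
  where
    extend : ∀ {e} → e ⊆ M → Any (_⊆ M) (map (e ++_) (choices Ess))
    extend e⊆M = Any.map⁺ (Any.map {P = _⊆ M} (++-⊆ e⊆M) (choices⁺ Ess rest))

module Strategy {V : Set} (_≟_ : DecidableEquality V) (m q : ℕ) (1≤m : 1 ≤ m) (1≤q : 1 ≤ q)
  (H : Fin m → Hypergraph V) (wellFormed : ∀ i → WellFormed (H i))
  (disjoint : ∀ i j → i ≢ j → Disjoint (vertices (H i)) (vertices (H j)))
  (Qf : ℕ) (floor : IsFloorQ q (m + ceilDivSuc (sumFin m (λ i → length (vertices (H i)))) q) Qf) where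

  open DecMembership _≟_ using (_∈?_)
  open DecSubset _≟_ using (_⊆?_)

  instance
    q≢0 : NonZero q
    q≢0 = >-nonZero 1≤q

  board : List V
  board = vertices (unionHyp m H)

  size : ℕ
  size = sumFin m (λ i → length (vertices (H i)))

  board-length : length board ≡ size
  board-length = length-concatMap (vertices ∘ H) (allFin m)

  N : ℕ
  N = m + ceilDivSuc size q

  open HarmonicWeights N
  open Harmonic weight-harmonic weight-≥2
  open BoxGame weight-harmonic m q

  module U = Game _≟_ (unionHyp m H) q
  module G (i : Fin m) = Game _≟_ (H i) Qf

  Vᵢ⊆board : ∀ i → vertices (H i) ⊆ board
  Vᵢ⊆board i x∈ = ∈-concat⁺′ x∈ (∈-map⁺ (vertices ∘ H) (∈-allFin i))

  won? : ∀ i M → Dec (G.Won i M)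
  won? i M = Any.any? (_⊆? M) (edges (H i))

  won-mono : ∀ i {M M′} → M ⊆ M′ → G.Won i M → G.Won i M′
  won-mono i {M} {M′} M⊆M′ = Any.map {P = _⊆ M} {Q = _⊆ M′} (λ e⊆M → ⊆-trans e⊆M M⊆M′)

  record Component (i : Fin m) : Set where
    constructor component
    field
      makerᵢ breakerᵢ : List V
      budget : ℕ
      winning : G.MakerWinsWithin i budget makerᵢ breakerᵢ
  open Component

  Active : (i : Fin m) → Component i → Set
  Active i c = ¬ G.Won i (makerᵢ c)

  active? : ∀ i c → Dec (Active i c)
  active? i c = ¬? (won? i (makerᵢ c))

  Unseen : Fin m → List V → V → Set
  Unseen i Bᵢ v = v ∈ vertices (H i) × v ∉ Bᵢ

  unseen? : ∀ i Bᵢ → Decidable (Unseen i Bᵢ)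
  unseen? i Bᵢ v = (v ∈? vertices (H i)) ×-dec ¬? (v ∈? Bᵢ)

  unseen-exclusive : ∀ {i j Bᵢ Bⱼ v} → Unseen i Bᵢ v → Unseen j Bⱼ v → i ≡ j
  unseen-exclusive {i} {j} (v∈Vᵢ , _) (v∈Vⱼ , _) with i ≟ᶠ j
  ... | yes i≡j = i≡j
  ... | no  i≢j = contradiction (v∈Vᵢ , v∈Vⱼ) (disjoint i j i≢j)

  pending : (i : Fin m) → Component i → List V → List V
  pending i c B = filter (unseen? i (breakerᵢ c)) B

  record Position (r T : ℕ) : Set where
    field
      maker breaker : List V
      games : (i : Fin m) → Component i
      budget-total : sumFin m (λ i → budget (games i)) ≡ T
      maker-unique : Unique maker
      breaker-unique : Unique breaker
      maker∉breaker : ∀ {x} → x ∈ maker → x ∉ breaker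
      maker-length : length maker ≡ r
      breaker-length : length breaker ≡ r * q
      maker-board : maker ⊆ board
      breaker-board : breaker ⊆ board
      makerᵢ⊆maker : ∀ i → makerᵢ (games i) ⊆ maker
      maker⊆makerᵢ : ∀ i {x} → x ∈ vertices (H i) → x ∈ maker → x ∈ makerᵢ (games i)
      box : BoxInvariant r (λ i → length (pending i (games i) breaker)) (λ i → Active i (games i))

  rounds-bound : ∀ {r T} → Position r T → suc r ≤ N
  rounds-bound {r} s = +-mono-≤ 1≤m (begin
    r                                  ≡⟨ m*n/n≡m r (suc q) ⟨
    r * suc q / suc q                  ≤⟨ /-monoˡ-≤ (suc q) claimed ⟩
    size / suc q                       ≤⟨ /-monoˡ-≤ (suc q) (m≤m+n size q) ⟩
    ceilDivSuc size q                  ∎)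
    where
      open ≤-Reasoning
      open Position s
      claimed : r * suc q ≤ size
      claimed = begin
        r * suc q                          ≡⟨ *-suc r q ⟩
        r + r * q                          ≡⟨ cong₂ _+_ maker-length breaker-length ⟨
        length maker + length breaker      ≡⟨ length-++ maker ⟨
        length (maker ++ breaker)          ≤⟨ Unique-⊆⇒length≤ _≟_
                                                (Unique.++⁺ maker-unique breaker-unique (λ (x∈M , x∈B) → maker∉breaker x∈M x∈B))
                                                (++-⊆ maker-board breaker-board) ⟩
        length board                       ≡⟨ board-length ⟩
        size                               ∎

  respond : ∀ i {t M B} → ¬ G.Won i M → G.MakerWinsWithin i t M B →
            Σ ℕ λ t′ → t ≡ suc t′ × ((S : List V) → G.BreakerMove i M B S →
              ∃[ v ] (G.Free i M (S ++ B) v × G.MakerWinsWithin i t′ (v ∷ M) (S ++ B)))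
  respond i {zero}  ¬won won        = contradiction won ¬won
  respond i {suc t} ¬won (inj₁ won) = contradiction won ¬won
  respond i {suc t} ¬won (inj₂ f)   = t , refl , f

  module Round {r T : ℕ} (s : Position r (suc T)) (i₀ : Fin m) (active-i₀ : Active i₀ (Position.games s i₀))
               (S : List V) (move : U.BreakerMove (Position.maker s) (Position.breaker s) S) where
    open Position s

    S-unique : Unique S
    S-unique = proj₁ move

    S-free : All (U.Free maker breaker) S
    S-free = proj₁ (proj₂ move)

    S-size : length S ≡ q ⊓ length (U.freeList maker breaker)
    S-size = proj₂ (proj₂ move)

    S∉maker : ∀ {x} → x ∈ S → x ∉ maker
    S∉maker x∈S = proj₁ (proj₂ (All.lookup S-free x∈S))

    S∉breaker : ∀ {x} → x ∈ S → x ∉ breaker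
    S∉breaker x∈S = proj₂ (proj₂ (All.lookup S-free x∈S))

    breaker₁ : List V
    breaker₁ = S ++ breaker

    breaker₁-unique : Unique breaker₁
    breaker₁-unique = Unique.++⁺ S-unique breaker-unique (λ (x∈S , x∈B) → S∉breaker x∈S x∈B)

    breaker₁∉maker : ∀ {x} → x ∈ breaker₁ → x ∉ maker
    breaker₁∉maker x∈ x∈M = [ (λ x∈S → S∉maker x∈S x∈M) , maker∉breaker x∈M ]′ (∈-++⁻ S x∈)

    load load₁ : Fin m → ℕ
    load  j = length (pending j (games j) breaker)
    load₁ j = length (pending j (games j) breaker₁)

    breaker-adds : ∀ J → Unique J → sum (map load₁ J) ≤ sum (map load J) + q
    breaker-adds J uJ = begin
      sum (map load₁ J)                  ≡⟨ cong sum (map-cong split J) ⟩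
      sum (map (λ j → new j + load j) J) ≡⟨ sum-map-+ new load J ⟩
      sum (map new J) + sum (map load J) ≤⟨ +-monoˡ-≤ _ new≤q ⟩
      q + sum (map load J)               ≡⟨ +-comm q _ ⟩
      sum (map load J) + q               ∎
      where
        open ≤-Reasoning
        new : Fin m → ℕ
        new j = length (filter (unseen? j (breakerᵢ (games j))) S)
        split : ∀ j → load₁ j ≡ new j + load j
        split j = trans (cong length (filter-++ (unseen? j _) S breaker)) (length-++ (filter (unseen? j _) S))
        new≤q : sum (map new J) ≤ q
        new≤q = ≤-trans (sum-length-filter-exclusive _≟_ (λ j → unseen? j (breakerᵢ (games j))) unseen-exclusive S-unique uJ)
                        (≤-trans (≤-reflexive S-size) (m⊓n≤m q _))

    actives : List (Fin m)
    actives = filter (λ j → active? j (games j)) (allFin m)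

    i : Fin m
    i = argmax load₁ i₀ actives

    active-i : Active i (games i)
    active-i = argmax-all load₁ {P = λ j → Active j (games j)} active-i₀
      (All.tabulate (λ j∈ → proj₂ (∈-filter⁻ (λ j → active? j (games j)) {xs = allFin m} j∈)))

    maximal : ∀ j → Active j (games j) → load₁ j ≤ load₁ i
    maximal j active-j = All.lookup (f[xs]≤f[argmax] i₀ actives)
      (∈-filter⁺ (λ j → active? j (games j)) (∈-allFin j) active-j)

    load-bound : load₁ i ≤ Qf
    load-bound = harmonic≤floor q r (load₁ i) floor (rounds-bound s)
                   (boxInvariant-single box (rounds-bound s) breaker-adds active-i)

    Mᵢ Bᵢ Fᵢ X : List V
    Mᵢ = makerᵢ (games i)
    Bᵢ = breakerᵢ (games i)
    Fᵢ = G.freeList i Mᵢ Bᵢ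
    X  = pending i (games i) breaker₁

    X-member : ∀ {x} → x ∈ X → x ∈ breaker₁ × Unseen i Bᵢ x
    X-member = ∈-filter⁻ (unseen? i Bᵢ) {xs = breaker₁}

    X⊆Fᵢ : X ⊆ Fᵢ
    X⊆Fᵢ x∈X = let x∈B₁ , x∈Vᵢ , x∉Bᵢ = X-member x∈X in
      Free⇒∈freeList _≟_ (H i) Qf (x∈Vᵢ , (λ x∈Mᵢ → breaker₁∉maker x∈B₁ (makerᵢ⊆maker i x∈Mᵢ)) , x∉Bᵢ)

    X-unique : Unique X
    X-unique = Unique.filter⁺ (unseen? i Bᵢ) breaker₁-unique

    Fᵢ-unique : Unique Fᵢ
    Fᵢ-unique = Unique.filter⁺ _ (proj₁ (wellFormed i))

    X-fits : length X ≤ Qf ⊓ length Fᵢ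
    X-fits = ⊓-glb load-bound (Unique-⊆⇒length≤ _≟_ X-unique X⊆Fᵢ)

    padding : Σ (List V) λ Y → length Y ≡ Qf ⊓ length Fᵢ ∸ length X × Unique (X ++ Y) × X ++ Y ⊆ Fᵢ
    padding = extend-⊆ _≟_ _ Fᵢ-unique X-unique X⊆Fᵢ (≤-trans (≤-reflexive (m+[n∸m]≡n X-fits)) (m⊓n≤n Qf _))

    Sᵢ : List V
    Sᵢ = X ++ proj₁ padding

    simulated-move : G.BreakerMove i Mᵢ Bᵢ Sᵢ
    simulated-move = let _ , Y-length , Sᵢ-unique , Sᵢ⊆Fᵢ = padding in
      Sᵢ-unique ,
      All.tabulate (∈freeList⇒Free _≟_ (H i) Qf ∘ Sᵢ⊆Fᵢ) ,
      trans (length-++ X) (trans (cong (length X +_) Y-length) (m+[n∸m]≡n X-fits))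

    Response : Set
    Response = Σ ℕ λ t′ → budget (games i) ≡ suc t′ ×
                 ∃[ v ] (G.Free i Mᵢ (Sᵢ ++ Bᵢ) v × G.MakerWinsWithin i t′ (v ∷ Mᵢ) (Sᵢ ++ Bᵢ))

    response : Response
    response = let t′ , budget≡ , strategy = respond i active-i (winning (games i)) in
      t′ , budget≡ , strategy Sᵢ simulated-move

    t′ : ℕ
    t′ = proj₁ response

    v : V
    v = proj₁ (proj₂ (proj₂ response))

    v-freeᵢ : G.Free i Mᵢ (Sᵢ ++ Bᵢ) v
    v-freeᵢ = proj₁ (proj₂ (proj₂ (proj₂ response)))

    v∈Vᵢ : v ∈ vertices (H i)
    v∈Vᵢ = proj₁ v-freeᵢ

    -- The whole pending list X was part of the simulated move.
    seen : ∀ {x} → x ∈ vertices (H i) → x ∈ breaker₁ → x ∈ Sᵢ ++ Bᵢ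
    seen {x} x∈Vᵢ x∈B₁ =
      [ ∈-++⁺ˡ ∘ ∈-++⁺ˡ
      , (λ ¬unseen → ∈-++⁺ʳ Sᵢ (decidable-stable (x ∈? Bᵢ) (¬unseen ∘ (x∈Vᵢ ,_))))
      ]′ (∈-filter-⊎ (unseen? i Bᵢ) x∈B₁)

    v∉maker : v ∉ maker
    v∉maker v∈M = proj₁ (proj₂ v-freeᵢ) (maker⊆makerᵢ i v∈Vᵢ v∈M)

    v∉breaker₁ : v ∉ breaker₁
    v∉breaker₁ v∈B₁ = proj₂ (proj₂ v-freeᵢ) (seen v∈Vᵢ v∈B₁)

    v-free : U.Free maker breaker₁ v
    v-free = Vᵢ⊆board i v∈Vᵢ , v∉maker , v∉breaker₁

    S-length : length S ≡ q
    S-length = full-move _≟_ q S-size S-unique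
      (λ x∈S → Free⇒∈freeList _≟_ (unionHyp m H) q (All.lookup S-free x∈S))
      (Free⇒∈freeList _≟_ (unionHyp m H) q (Vᵢ⊆board i v∈Vᵢ , v∉maker , v∉breaker₁ ∘ ∈-++⁺ʳ S))
      (v∉breaker₁ ∘ ∈-++⁺ˡ)

    game′ : Component i
    game′ = component (v ∷ Mᵢ) (Sᵢ ++ Bᵢ) t′ (proj₂ (proj₂ (proj₂ (proj₂ response))))

    games′ : (j : Fin m) → Component j
    games′ = update games i game′

    next : Position (suc r) T
    next = record
      { maker          = v ∷ maker
      ; breaker        = breaker₁
      ; games          = games′
      ; budget-total   = suc-injective (trans (sym budget-decrement) budget-total)
      ; maker-unique   = Unique-∷ v∉maker maker-unique
      ; breaker-unique = breaker₁-unique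
      ; maker∉breaker  = λ { (here refl) → v∉breaker₁ ; (there x∈M) x∈B₁ → breaker₁∉maker x∈B₁ x∈M }
      ; maker-length   = cong suc maker-length
      ; breaker-length = trans (length-++ S) (cong₂ _+_ S-length breaker-length)
      ; maker-board    = λ { (here refl) → Vᵢ⊆board i v∈Vᵢ ; (there x∈M) → maker-board x∈M }
      ; breaker-board  = ++-⊆ (λ x∈S → proj₁ (All.lookup S-free x∈S)) breaker-board
      ; makerᵢ⊆maker   = update-elim (λ _ c → makerᵢ c ⊆ v ∷ maker) games i game′
                           (∷⁺ʳ v (makerᵢ⊆maker i)) (λ j _ → ⊆-trans (makerᵢ⊆maker j) (xs⊆x∷xs maker v))
      ; maker⊆makerᵢ   = update-elim (λ j c → ∀ {x} → x ∈ vertices (H j) → x ∈ v ∷ maker → x ∈ makerᵢ c)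
                           games i game′
                           (λ { _ (here refl) → here refl ; x∈Vᵢ (there x∈M) → there (maker⊆makerᵢ i x∈Vᵢ x∈M) })
                           (λ { j j≢i x∈Vⱼ (here refl) → contradiction (x∈Vⱼ , v∈Vᵢ) (disjoint j i j≢i)
                              ; j _   x∈Vⱼ (there x∈M) → maker⊆makerᵢ j x∈Vⱼ x∈M })
      ; box            = boxInvariant-step box breaker-adds active-i maximal emptied kept shrinks
      }
      where
        budget-decrement : sumFin m (λ j → budget (games j)) ≡ suc (sumFin m (λ j → budget (games′ j)))
        budget-decrement = sum-map-decrement (budget ∘ games) (budget ∘ games′) i
          (trans (proj₁ (proj₂ response)) (cong (suc ∘ budget) (sym (update-self games i game′))))
          (λ j j≢i → cong budget (sym (update-other games game′ j≢i)))
          (Unique.allFin⁺ m) (∈-allFin i)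
        emptied : length (pending i (games′ i) breaker₁) ≡ 0
        emptied = trans (cong (λ c → length (pending i c breaker₁)) (update-self games i game′))
          (cong length (filter-none (unseen? i (Sᵢ ++ Bᵢ))
            (All.tabulate λ x∈B₁ (x∈Vᵢ , x∉) → x∉ (seen x∈Vᵢ x∈B₁))))
        kept : ∀ j → j ≢ i → length (pending j (games′ j) breaker₁) ≡ load₁ j
        kept j j≢i = cong (λ c → length (pending j c breaker₁)) (update-other games game′ j≢i)
        shrinks : ∀ j → Active j (games′ j) → Active j (games j)
        shrinks = update-elim (λ j c → Active j c → Active j (games j)) games i game′
          (λ active won → active (won-mono i (xs⊆x∷xs Mᵢ v) won)) (λ _ _ active → active)

  module _ {r T} (s : Position r T) where
    open Position s

    all-won : (∀ j → G.Won j (makerᵢ (games j))) → U.Won maker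
    all-won won = choices⁺ (map (edges ∘ H) (allFin m))
      (All.map⁺ (All.universal (λ j → won-mono j (makerᵢ⊆maker j) (won j)) (allFin m)))

    none-active⇒won : ¬ (∃ λ j → Active j (games j)) → U.Won maker
    none-active⇒won none = all-won (λ j → decidable-stable (won? j (makerᵢ (games j))) (none ∘ (j ,_)))

    active⇒budget≥1 : ∀ j → Active j (games j) → 1 ≤ budget (games j)
    active⇒budget≥1 j active = let _ , budget≡ , _ = respond j active (winning (games j)) in
      subst (1 ≤_) (sym budget≡) (s≤s z≤n)

    budget≤total : ∀ j → budget (games j) ≤ T
    budget≤total j = ≤-trans (sum-map-≥ (budget ∘ games) (∈-allFin j)) (≤-reflexive budget-total)

  play : ∀ T {r} (s : Position r T) → U.MakerWinsWithin T (Position.maker s) (Position.breaker s)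
  play T s with any? (λ j → active? j (Position.games s j))
  play zero    s | yes (i₀ , active) = contradiction (≤-trans (active⇒budget≥1 s i₀ active) (budget≤total s i₀)) λ ()
  play (suc T) s | yes (i₀ , active) = inj₂ λ S move → let open Round s i₀ active S move in v , v-free , play T next
  play zero    s | no none = none-active⇒won s none
  play (suc T) s | no none = inj₁ (none-active⇒won s none)

  start : (t : Fin m → ℕ) → (∀ i → MakerWins _≟_ (H i) Qf (t i)) → Position 0 (sumFin m t)
  start t wins = record
    { maker = [] ; breaker = [] ; games = λ i → component [] [] (t i) (wins i) ; budget-total = refl
    ; maker-unique = [] ; breaker-unique = [] ; maker∉breaker = λ () ; maker-length = refl ; breaker-length = refl
    ; maker-board = λ () ; breaker-board = λ () ; makerᵢ⊆maker = λ _ () ; maker⊆makerᵢ = λ _ _ ()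
    ; box = boxInvariant-start _
    }

theorem2p5 : {V : Set} (_≟_ : DecidableEquality V) (m q : ℕ) → 1 ≤ m → 1 ≤ q →
  (H : Fin m → Hypergraph V) →
  (∀ i → WellFormed (H i)) →
  (∀ i j → i ≢ j → Disjoint (vertices (H i)) (vertices (H j))) →
  (t : Fin m → ℕ) →
  (Qf : ℕ) →
  IsFloorQ q (m + ceilDivSuc (sumFin m (λ i → length (vertices (H i)))) q) Qf →
  (∀ i → MakerWins _≟_ (H i) Qf (t i)) →
  MakerWins _≟_ (unionHyp m H) q (sumFin m t)
theorem2p5 _≟_ m q 1≤m 1≤q H wellFormed disjoint t Qf floor wins = play (sumFin m t) (start t wins)
  where open Strategy _≟_ m q 1≤m 1≤q H wellFormed disjoint Qf floor
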